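{- For integers $n\ge 0$, $k\ge0$ and $l\ge 0$, $$t_{n,k}=\sum_{l=0}^{\lfloor (n-3k)/2\rfloor}\binom{n-3k-l}{l}\binom{n-2k-l}{k}\quad\text{and}\quad u_{n,l}=\sum_{k=0}^{\lfloor (n-2l)/3\rfloor}\binom{n-3k-l}{l}\binom{n-2k-l}{k},$$ where $t_{n,k}$ is the number of tilings of the honeycomb strip $H_n$ (by monomers, slanted dimers and trimers) with exactly $k$ trimers, and $u_{n,l}$ is the number of such tilings with exactly $l$ dimers.
   Context: The honeycomb strip $H_n$ consists of $n$ regular hexagons numbered $1,\dots,n$ arranged in two rows (odd-numbered on the bottom, even-numbered on top), hexagon $i$ sharing an edge with hexagons $i\pm1$ and $i\pm2$. The allowed tiles are: monomers $\{i\}$, slanted dimers $\{i,i+1\}$, and trimers $\{i,i+1,i+2\}$ (horizontal dimers $\{i,i+2\}$ are not allowed); a tiling is a partition of the hexagons of $H_n$ into such tiles, and $H_0$ has one (empty) tiling. Empty sums are $0$. -}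

module Defs where

open import Data.Nat using (ℕ; zero; suc; _+_; _*_; _∸_; _/_; _≤ᵇ_)
open import Data.Nat.Combinatorics using (_C_)
open import Data.List using (List; []; map; upTo)
open import Data.Nat.ListAction using (sum)
open import Data.Bool using (if_then_else_)

-- Every allowed tile is a set of
-- consecutive hexagons ({i}, {i,i+1}, {i,i+1,i+2}), so a tiling of H_n
-- (n ≥ 1) is determined by the tile containing hexagon n together with a
-- tiling of the remaining strip H_{n-1}, H_{n-2} or H_{n-3}.
data Tiling : ℕ → Set where
  empty  : Tiling 0
  mono   : ∀ {n} → Tiling n → Tiling (suc n)
  dimer  : ∀ {n} → Tiling n → Tiling (suc (suc n))
  trimer : ∀ {n} → Tiling n → Tiling (suc (suc (suc n)))

trimers : ∀ {n} → Tiling n → ℕ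
trimers empty      = 0
trimers (mono t)   = trimers t
trimers (dimer t)  = trimers t
trimers (trimer t) = suc (trimers t)

dimers : ∀ {n} → Tiling n → ℕ
dimers empty      = 0
dimers (mono t)   = dimers t
dimers (dimer t)  = suc (dimers t)
dimers (trimer t) = dimers t

term : ℕ → ℕ → ℕ → ℕ
term n k l = ((n ∸ 3 * k ∸ l) C l) * ((n ∸ 2 * k ∸ l) C k)

-- Σ_{l=0}^{⌊(n-3k)/2⌋} term n k l   (empty sum = 0 when n - 3k < 0)
tFormula : ℕ → ℕ → ℕ
tFormula n k =
  sum (map (term n k)
    (if 3 * k ≤ᵇ n then upTo (suc ((n ∸ 3 * k) / 2)) else []))

-- Σ_{k=0}^{⌊(n-2l)/3⌋} term n k l   (empty sum = 0 when n - 2l < 0)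
uFormula : ℕ → ℕ → ℕ
uFormula n l =
  sum (map (λ k → term n k l)
    (if 2 * l ≤ᵇ n then upTo (suc ((n ∸ 2 * l) / 3)) else []))

-- A tiling of H_n with m monomers, l dimers and k trimers is a word with m, l
-- and k occurrences of three letters, so n = m + 2l + 3k and there are
-- (m+l+k)!/(m! l! k!) = C(m+l, l) C(m+l+k, k) such tilings: with m = n - 2l - 3k
-- this is exactly the common summand of both formulas.  The count follows by
-- removing the last tile, which gives the trinomial Pascal rule (two binomial
-- Pascal steps).  Summing over the other statistic, constrained by 2l + 3k <= n,
-- gives t_{n,k} and u_{n,l}.
module Submission where

open import Defs
open import Data.Nat using (ℕ)
open import Data.Fin using (Fin)
open import Data.Product using (Σ; _×_)
open import Relation.Binary.PropositionalEquality using (_≡_)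
open import Function.Bundles using (_↔_)

open import Data.Bool using (true; false; if_then_else_)
open import Data.Empty using (⊥; ⊥-elim)
open import Data.Fin as Fin using (toℕ; fromℕ<)
open import Data.Fin.Properties using (0↔⊥; +↔⊎; toℕ<n; toℕ-fromℕ<; toℕ-injective)
open import Data.List using ([]; map; upTo; applyUpTo)
open import Data.List.Properties using (map-applyUpTo)
open import Data.Nat
  using (zero; suc; pred; _+_; _*_; _∸_; _/_; _≤ᵇ_; _≤_; _<_; z≤n; s≤s; s≤s⁻¹; NonZero)
open import Data.Nat.Combinatorics using (_C_; nCn≡1; nCk+nC[k+1]≡[n+1]C[k+1])
open import Data.Nat.DivMod using (m*n/n≡m; m/n*n≤m; /-monoˡ-≤)
open import Data.Nat.ListAction using (sum)
open import Data.Nat.Properties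
open import Data.Nat.Tactic.RingSolver using (solve-∀)
open import Data.Product using (_,_; proj₁)
open import Data.Product.Algebra using (Σ-assoc; ×-comm)
open import Data.Product.Function.Dependent.Propositional using (Σ-↔)
open import Data.Sum using (_⊎_; inj₁; inj₂)
open import Data.Sum.Function.Propositional using (_⊎-↔_)
open import Function.Base using (_∘_; id)
open import Function.Bundles using (mk↔ₛ′)
open import Function.Properties.Inverse using (↔-refl; ↔-sym; ↔-trans)
open import Relation.Binary.PropositionalEquality
  using (refl; sym; trans; cong; cong₂; subst; module ≡-Reasoning)
open import Relation.Nullary using (¬_)
open import Relation.Nullary.Reflects using (ofʸ; ofⁿ)

open ≡-Reasoning

↔Fin0 : {A : Set} → ¬ A → A ↔ Fin 0
↔Fin0 ¬a = mk↔ₛ′ (λ a → ⊥-elim (¬a a)) (λ ()) (λ ()) (λ a → ⊥-elim (¬a a))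

Fin-+-↔-⊎₃ : ∀ {a b c} → Fin (a + (b + c)) ↔ (Fin a ⊎ (Fin b ⊎ Fin c))
Fin-+-↔-⊎₃ {a} {b} = ↔-trans (+↔⊎ {a}) (↔-refl ⊎-↔ +↔⊎ {b})

Σ-Fin-suc↔⊎ : ∀ {c} {B : Fin (suc c) → Set} →
              Σ (Fin (suc c)) B ↔ (B Fin.zero ⊎ Σ (Fin c) (λ j → B (Fin.suc j)))
Σ-Fin-suc↔⊎ {c} {B} = mk↔ₛ′ to from to-from from-to
  where
  to : Σ (Fin (suc c)) B → B Fin.zero ⊎ Σ (Fin c) (λ j → B (Fin.suc j))
  to (Fin.zero  , b) = inj₁ b
  to (Fin.suc j , b) = inj₂ (j , b)
  from : B Fin.zero ⊎ Σ (Fin c) (λ j → B (Fin.suc j)) → Σ (Fin (suc c)) B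
  from (inj₁ b)       = Fin.zero , b
  from (inj₂ (j , b)) = Fin.suc j , b
  to-from : ∀ y → to (from y) ≡ y
  to-from (inj₁ b)       = refl
  to-from (inj₂ (j , b)) = refl
  from-to : ∀ x → from (to x) ≡ x
  from-to (Fin.zero  , b) = refl
  from-to (Fin.suc j , b) = refl

Σ-Fin↔sum : ∀ c (g : ℕ → ℕ) → Σ (Fin c) (λ j → Fin (g (toℕ j))) ↔ Fin (sum (applyUpTo g c))
Σ-Fin↔sum zero    g = ↔Fin0 (λ { (() , _) })
Σ-Fin↔sum (suc c) g =
  ↔-trans Σ-Fin-suc↔⊎ (↔-trans (↔-refl ⊎-↔ Σ-Fin↔sum c (g ∘ suc)) (↔-sym (+↔⊎ {g 0})))

module _ {A : Set} (d : A → ℕ) {c : ℕ} (d<c : ∀ x → d x < c) where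

  ↔Σ-fibres : A ↔ Σ (Fin c) (λ j → Σ A (λ x → d x ≡ toℕ j))
  ↔Σ-fibres = mk↔ₛ′ to point to-from (λ _ → refl)
    where
    to : A → Σ (Fin c) (λ j → Σ A (λ x → d x ≡ toℕ j))
    to x = fromℕ< (d<c x) , x , sym (toℕ-fromℕ< (d<c x))
    point : Σ (Fin c) (λ j → Σ A (λ x → d x ≡ toℕ j)) → A
    point (_ , x , _) = x
    to-from : ∀ y → to (point y) ≡ y
    to-from (j , x , p) with toℕ-injective (trans (toℕ-fromℕ< (d<c x)) p)
    ... | refl = cong (λ q → j , x , q) (≡-irrelevant _ p)

  partition↔sum : (g : ℕ → ℕ) → (∀ i → i < c → Σ A (λ x → d x ≡ i) ↔ Fin (g i)) →
                  A ↔ Fin (sum (map g (upTo c)))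
  partition↔sum g fibre↔ =
    ↔-trans ↔Σ-fibres
      (↔-trans (Σ-↔ ↔-refl (λ {j} → fibre↔ (toℕ j) (toℕ<n j)))
      (subst (λ xs → Σ (Fin c) (λ j → Fin (g (toℕ j))) ↔ Fin (sum xs))
             (sym (map-applyUpTo id g c)) (Σ-Fin↔sum c g)))

*≤⇒≤/ : ∀ q x m .{{_ : NonZero q}} → q * x ≤ m → x ≤ m / q
*≤⇒≤/ q x m qx≤m =
  subst (_≤ m / q) (m*n/n≡m x q) (/-monoˡ-≤ q (subst (_≤ m) (*-comm q x) qx≤m))

≤/⇒*≤ : ∀ q x m .{{_ : NonZero q}} → x ≤ m / q → q * x ≤ m
≤/⇒*≤ q x m x≤m/q =
  ≤-trans (*-monoʳ-≤ q x≤m/q) (subst (_≤ m) (*-comm (m / q) q) (m/n*n≤m m q))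

+∸∸-cancel : ∀ x b c → x + b + c ∸ c ∸ b ≡ x
+∸∸-cancel x b c = trans (cong (_∸ b) (m+n∸n≡m (x + b) c)) (m+n∸n≡m x b)

partition↔guardedSum :
  ∀ n b q .{{_ : NonZero q}} {A : Set} (d : A → ℕ) (g : ℕ → ℕ) →
  (∀ x → q * d x + b ≤ n) →
  (∀ i → q * i + b ≤ n → Σ A (λ x → d x ≡ i) ↔ Fin (g i)) →
  A ↔ Fin (sum (map g (if b ≤ᵇ n then upTo (suc ((n ∸ b) / q)) else [])))
partition↔guardedSum n b q d g bound fibre↔ with b ≤ᵇ n | ≤ᵇ-reflects-≤ b n
... | false | ofⁿ b≰n = ↔Fin0 (λ x → b≰n (≤-trans (m≤n+m b _) (bound x)))
... | true  | ofʸ b≤n = partition↔sum d d<c g (λ i i<c → fibre↔ i (in-range i<c))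
  where
  d<c : ∀ x → d x < suc ((n ∸ b) / q)
  d<c x = s≤s (*≤⇒≤/ q (d x) (n ∸ b) (m+n≤o⇒m≤o∸n _ (bound x)))
  in-range : ∀ {i} → i < suc ((n ∸ b) / q) → q * i + b ≤ n
  in-range i<c = m≤o∸n⇒m+n≤o _ b≤n (≤/⇒*≤ q _ (n ∸ b) (s≤s⁻¹ i<c))

binomial : ℕ → ℕ → ℕ
binomial a b = (a + b) C b

multinomial : ℕ → ℕ → ℕ → ℕ
multinomial m l k = binomial m l * binomial (m + l) k

atPred : (ℕ → ℕ) → ℕ → ℕ
atPred f zero    = 0
atPred f (suc n) = f n

binomial-pascal : ∀ a b → binomial (suc a) (suc b) ≡ binomial a (suc b) + binomial (suc a) b
binomial-pascal a b = begin
  suc (a + suc b) C suc b                ≡⟨ sym (nCk+nC[k+1]≡[n+1]C[k+1] (a + suc b) b) ⟩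
  (a + suc b) C b + (a + suc b) C suc b  ≡⟨ +-comm ((a + suc b) C b) _ ⟩
  (a + suc b) C suc b + (a + suc b) C b  ≡⟨ cong (λ x → (a + suc b) C suc b + x C b) (+-suc a b) ⟩
  (a + suc b) C suc b + suc (a + b) C b  ∎

binomial*-pascal : ∀ a b (h : ℕ → ℕ) → 0 < a + b →
  binomial a b * h (pred (a + b)) ≡
  atPred (λ a′ → binomial a′ b * h (a′ + b)) a + atPred (λ b′ → binomial a b′ * h (a + b′)) b
binomial*-pascal (suc a) (suc b) h _ = begin
  binomial (suc a) (suc b) * h (a + suc b)
    ≡⟨ cong (_* h (a + suc b)) (binomial-pascal a b) ⟩
  (binomial a (suc b) + binomial (suc a) b) * h (a + suc b)
    ≡⟨ *-distribʳ-+ (h (a + suc b)) (binomial a (suc b)) _ ⟩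
  binomial a (suc b) * h (a + suc b) + binomial (suc a) b * h (a + suc b)
    ≡⟨ cong (λ x → binomial a (suc b) * h (a + suc b) + binomial (suc a) b * h x) (+-suc a b) ⟩
  binomial a (suc b) * h (a + suc b) + binomial (suc a) b * h (suc a + b) ∎
binomial*-pascal (suc a) zero h _ = sym (+-identityʳ _)
binomial*-pascal zero (suc b) h _ =
  trans (cong (_* h b) (nCn≡1 (suc b))) (cong (_* h b) (sym (nCn≡1 b)))

binomial-pascalʳ : ∀ a b → 0 < a → binomial a (suc b) ≡ binomial (pred a) (suc b) + binomial a b
binomial-pascalʳ (suc a) b _ = binomial-pascal a b

multinomial-pascal-suc : ∀ m l k → 0 < m + l →
  multinomial m l (suc k) ≡
  atPred (λ m′ → multinomial m′ l (suc k)) m + (atPred (λ l′ → multinomial m l′ (suc k)) l + multinomial m l k)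
multinomial-pascal-suc m l k pos = begin
  binomial m l * binomial (m + l) (suc k)
    ≡⟨ cong (binomial m l *_) (binomial-pascalʳ (m + l) k pos) ⟩
  binomial m l * (binomial (pred (m + l)) (suc k) + binomial (m + l) k)
    ≡⟨ *-distribˡ-+ (binomial m l) (binomial (pred (m + l)) (suc k)) _ ⟩
  binomial m l * binomial (pred (m + l)) (suc k) + multinomial m l k
    ≡⟨ cong (_+ multinomial m l k) (binomial*-pascal m l (λ a → binomial a (suc k)) pos) ⟩
  (M + L) + multinomial m l k
    ≡⟨ +-assoc M L _ ⟩
  M + (L + multinomial m l k) ∎
  where
  M = atPred (λ m′ → multinomial m′ l (suc k)) m
  L = atPred (λ l′ → multinomial m l′ (suc k)) l

multinomial-pascal : ∀ m l k → 0 < m + l + k →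
  multinomial m l k ≡
  atPred (λ m′ → multinomial m′ l k) m + (atPred (λ l′ → multinomial m l′ k) l + atPred (multinomial m l) k)
multinomial-pascal m l zero pos = begin
  binomial m l * 1
    ≡⟨ binomial*-pascal m l (λ _ → 1) (subst (0 <_) (+-identityʳ (m + l)) pos) ⟩
  atPred (λ m′ → multinomial m′ l 0) m + atPred (λ l′ → multinomial m l′ 0) l
    ≡⟨ cong (atPred (λ m′ → multinomial m′ l 0) m +_) (sym (+-identityʳ _)) ⟩
  atPred (λ m′ → multinomial m′ l 0) m + (atPred (λ l′ → multinomial m l′ 0) l + 0) ∎
multinomial-pascal zero zero (suc k) _ = begin
  1 * (suc k C suc k) ≡⟨ cong (1 *_) (nCn≡1 (suc k)) ⟩
  1                   ≡⟨ cong (1 *_) (sym (nCn≡1 k)) ⟩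
  1 * (k C k)         ∎
multinomial-pascal (suc m) l       (suc k) _ = multinomial-pascal-suc (suc m) l k (s≤s z≤n)
multinomial-pascal zero    (suc l) (suc k) _ = multinomial-pascal-suc zero (suc l) k (s≤s z≤n)

data TilingWith : ℕ → ℕ → ℕ → Set where
  empty  : TilingWith 0 0 0
  mono   : ∀ {n l k} → TilingWith n l k → TilingWith (suc n) l k
  dimer  : ∀ {n l k} → TilingWith n l k → TilingWith (2 + n) (suc l) k
  trimer : ∀ {n l k} → TilingWith n l k → TilingWith (3 + n) l (suc k)

annotate : ∀ {n} (t : Tiling n) → TilingWith n (dimers t) (trimers t)
annotate empty      = empty
annotate (mono t)   = mono (annotate t)
annotate (dimer t)  = dimer (annotate t)
annotate (trimer t) = trimer (annotate t)

forget : ∀ {n l k} → TilingWith n l k → Σ (Tiling n) (λ t → dimers t ≡ l × trimers t ≡ k)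
forget empty = empty , refl , refl
forget (mono w) with forget w
... | t , refl , refl = mono t , refl , refl
forget (dimer w) with forget w
... | t , refl , refl = dimer t , refl , refl
forget (trimer w) with forget w
... | t , refl , refl = trimer t , refl , refl

counted↔TilingWith : ∀ {n l k} → Σ (Tiling n) (λ t → dimers t ≡ l × trimers t ≡ k) ↔ TilingWith n l k
counted↔TilingWith = mk↔ₛ′ to forget to-forget forget-to
  where
  to : ∀ {n l k} → Σ (Tiling n) (λ t → dimers t ≡ l × trimers t ≡ k) → TilingWith n l k
  to (t , refl , refl) = annotate t
  to-forget : ∀ {n l k} (w : TilingWith n l k) → to (forget w) ≡ w
  to-forget empty = refl
  to-forget (mono w) with forget w | to-forget w
  ... | t , refl , refl | refl = refl
  to-forget (dimer w) with forget w | to-forget w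
  ... | t , refl , refl | refl = refl
  to-forget (trimer w) with forget w | to-forget w
  ... | t , refl , refl | refl = refl
  forget-annotate : ∀ {n} (t : Tiling n) → forget (annotate t) ≡ (t , refl , refl)
  forget-annotate empty = refl
  forget-annotate (mono t) rewrite forget-annotate t = refl
  forget-annotate (dimer t) rewrite forget-annotate t = refl
  forget-annotate (trimer t) rewrite forget-annotate t = refl
  forget-to : ∀ {n l k} (x : Σ (Tiling n) (λ t → dimers t ≡ l × trimers t ≡ k)) → forget (to x) ≡ x
  forget-to (t , refl , refl) = forget-annotate t

length-dimer : ∀ m l k → m + 2 * suc l + 3 * k ≡ 2 + (m + 2 * l + 3 * k)
length-dimer = solve-∀

length-trimer : ∀ m l k → m + 2 * l + 3 * suc k ≡ 3 + (m + 2 * l + 3 * k)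
length-trimer = solve-∀

length-bound : ∀ {n l k} → TilingWith n l k → 2 * l + 3 * k ≤ n
length-bound empty = z≤n
length-bound (mono w) = m≤n⇒m≤1+n (length-bound w)
length-bound (dimer {n} {l} {k} w) =
  subst (_≤ 2 + n) (sym (length-dimer 0 l k)) (s≤s (s≤s (length-bound w)))
length-bound (trimer {n} {l} {k} w) =
  subst (_≤ 3 + n) (sym (length-trimer 0 l k)) (s≤s (s≤s (s≤s (length-bound w))))

-- A tiling of H_(n+1) ending in a dimer (trimer), with that last tile removed.
EndsInDimer : ℕ → ℕ → ℕ → Set
EndsInDimer n       zero    k = ⊥
EndsInDimer zero    (suc l) k = ⊥
EndsInDimer (suc n) (suc l) k = TilingWith n l k

EndsInTrimer : ℕ → ℕ → ℕ → Set
EndsInTrimer n             l zero    = ⊥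
EndsInTrimer zero          l (suc k) = ⊥
EndsInTrimer (suc zero)    l (suc k) = ⊥
EndsInTrimer (suc (suc n)) l (suc k) = TilingWith n l k

lastTile↔ : ∀ {n l k} → TilingWith (suc n) l k ↔ (TilingWith n l k ⊎ (EndsInDimer n l k ⊎ EndsInTrimer n l k))
lastTile↔ = mk↔ₛ′ split join split-join join-split
  where
  split : ∀ {n l k} → TilingWith (suc n) l k → TilingWith n l k ⊎ (EndsInDimer n l k ⊎ EndsInTrimer n l k)
  split (mono w)   = inj₁ w
  split (dimer w)  = inj₂ (inj₁ w)
  split (trimer w) = inj₂ (inj₂ w)
  join : ∀ {n l k} → TilingWith n l k ⊎ (EndsInDimer n l k ⊎ EndsInTrimer n l k) → TilingWith (suc n) l k
  join (inj₁ w)        = mono w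
  join (inj₂ (inj₁ w)) = join-dimer w
    where
    join-dimer : ∀ {n l k} → EndsInDimer n l k → TilingWith (suc n) l k
    join-dimer {suc n} {suc l} w = dimer w
  join (inj₂ (inj₂ w)) = join-trimer w
    where
    join-trimer : ∀ {n l k} → EndsInTrimer n l k → TilingWith (suc n) l k
    join-trimer {suc (suc n)} {k = suc k} w = trimer w
  split-join : ∀ {n l k} (y : TilingWith n l k ⊎ (EndsInDimer n l k ⊎ EndsInTrimer n l k)) → split (join y) ≡ y
  split-join (inj₁ w) = refl
  split-join {suc n} {suc l} (inj₂ (inj₁ w)) = refl
  split-join {suc (suc n)} {k = suc k} (inj₂ (inj₂ w)) = refl
  join-split : ∀ {n l k} (w : TilingWith (suc n) l k) → join (split w) ≡ w
  join-split (mono w)   = refl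
  join-split (dimer w)  = refl
  join-split (trimer w) = refl

tiles-positive : ∀ {n} m l k → suc n ≡ m + 2 * l + 3 * k → 0 < m + l + k
tiles-positive (suc m) l       k       _ = s≤s z≤n
tiles-positive zero    (suc l) k       _ = s≤s z≤n
tiles-positive zero    zero    (suc k) _ = s≤s z≤n

mutual
  TilingWith↔multinomial : ∀ n m l k → n ≡ m + 2 * l + 3 * k → TilingWith n l k ↔ Fin (multinomial m l k)
  TilingWith↔multinomial zero zero    zero    zero    _  =
    mk↔ₛ′ (λ _ → Fin.zero) (λ _ → empty) (λ { Fin.zero → refl ; (Fin.suc ()) }) (λ { empty → refl })
  TilingWith↔multinomial zero (suc m) l       k       ()
  TilingWith↔multinomial zero zero    (suc l) k       ()
  TilingWith↔multinomial zero zero    zero    (suc k) ()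
  TilingWith↔multinomial (suc n) m l k eq =
    subst (λ N → TilingWith (suc n) l k ↔ Fin N) (sym (multinomial-pascal m l k (tiles-positive m l k eq)))
      (↔-trans lastTile↔
        (↔-trans (endsInMono↔ n m l k eq ⊎-↔ (endsInDimer↔ n m l k eq ⊎-↔ endsInTrimer↔ n m l k eq))
          (↔-sym Fin-+-↔-⊎₃)))

  endsInMono↔ : ∀ n m l k → suc n ≡ m + 2 * l + 3 * k →
                TilingWith n l k ↔ Fin (atPred (λ m′ → multinomial m′ l k) m)
  endsInMono↔ n (suc m) l k eq = TilingWith↔multinomial n m l k (suc-injective eq)
  endsInMono↔ n zero    l k eq = ↔Fin0 (λ w → 1+n≰n (subst (_≤ n) (sym eq) (length-bound w)))

  endsInDimer↔ : ∀ n m l k → suc n ≡ m + 2 * l + 3 * k →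
                 EndsInDimer n l k ↔ Fin (atPred (λ l′ → multinomial m l′ k) l)
  endsInDimer↔ n       m zero    k eq = ↔-sym 0↔⊥
  endsInDimer↔ zero    m (suc l) k eq with () ← trans eq (length-dimer m l k)
  endsInDimer↔ (suc n) m (suc l) k eq =
    TilingWith↔multinomial n m l k (suc-injective (suc-injective (trans eq (length-dimer m l k))))

  endsInTrimer↔ : ∀ n m l k → suc n ≡ m + 2 * l + 3 * k →
                  EndsInTrimer n l k ↔ Fin (atPred (multinomial m l) k)
  endsInTrimer↔ n             m l zero    eq = ↔-sym 0↔⊥
  endsInTrimer↔ zero          m l (suc k) eq with () ← trans eq (length-trimer m l k)
  endsInTrimer↔ (suc zero)    m l (suc k) eq with () ← trans eq (length-trimer m l k)
  endsInTrimer↔ (suc (suc n)) m l (suc k) eq =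
    TilingWith↔multinomial n m l k (suc-injective (suc-injective (suc-injective (trans eq (length-trimer m l k)))))

term≡multinomial : ∀ m l k → term (m + 2 * l + 3 * k) k l ≡ multinomial m l k
term≡multinomial m l k = cong₂ (λ a b → (a C l) * (b C k)) non-trimers tiles
  where
  regroup₁ : ∀ m l k → m + 2 * l + 3 * k ≡ m + l + l + 3 * k
  regroup₁ = solve-∀
  regroup₂ : ∀ m l k → m + 2 * l + 3 * k ≡ m + l + k + l + 2 * k
  regroup₂ = solve-∀
  non-trimers : m + 2 * l + 3 * k ∸ 3 * k ∸ l ≡ m + l
  non-trimers = trans (cong (λ x → x ∸ 3 * k ∸ l) (regroup₁ m l k)) (+∸∸-cancel (m + l) l (3 * k))
  tiles : m + 2 * l + 3 * k ∸ 2 * k ∸ l ≡ m + l + k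
  tiles = trans (cong (λ x → x ∸ 2 * k ∸ l) (regroup₂ m l k)) (+∸∸-cancel (m + l + k) l (2 * k))

counted↔term : ∀ n l k → 2 * l + 3 * k ≤ n →
               Σ (Tiling n) (λ t → dimers t ≡ l × trimers t ≡ k) ↔ Fin (term n k l)
counted↔term n l k bound =
  subst (λ N → Σ (Tiling n) (λ t → dimers t ≡ l × trimers t ≡ k) ↔ Fin N) multinomial≡term
    (↔-trans counted↔TilingWith (TilingWith↔multinomial n m l k n≡length))
  where
  m = n ∸ (2 * l + 3 * k)
  n≡length : n ≡ m + 2 * l + 3 * k
  n≡length = trans (sym (m∸n+n≡m bound)) (sym (+-assoc m (2 * l) (3 * k)))
  multinomial≡term : multinomial m l k ≡ term n k l
  multinomial≡term = sym (trans (cong (λ n → term n k l) n≡length) (term≡multinomial m l k))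

tilings-by-trimers : ∀ n k → Σ (Tiling n) (λ t → trimers t ≡ k) ↔ Fin (tFormula n k)
tilings-by-trimers n k = partition↔guardedSum n (3 * k) 2 (dimers ∘ proj₁) (term n k) bound fibre↔
  where
  bound : ∀ x → 2 * dimers (proj₁ x) + 3 * k ≤ n
  bound (t , refl) = length-bound (annotate t)
  fibre↔ : ∀ l → 2 * l + 3 * k ≤ n →
           Σ (Σ (Tiling n) (λ t → trimers t ≡ k)) (λ x → dimers (proj₁ x) ≡ l) ↔ Fin (term n k l)
  fibre↔ l le = ↔-trans Σ-assoc (↔-trans (Σ-↔ ↔-refl (×-comm _ _)) (counted↔term n l k le))

tilings-by-dimers : ∀ n l → Σ (Tiling n) (λ t → dimers t ≡ l) ↔ Fin (uFormula n l)
tilings-by-dimers n l = partition↔guardedSum n (2 * l) 3 (trimers ∘ proj₁) (λ k → term n k l) bound fibre↔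
  where
  bound : ∀ x → 3 * trimers (proj₁ x) + 2 * l ≤ n
  bound (t , refl) = subst (_≤ n) (+-comm (2 * dimers t) _) (length-bound (annotate t))
  fibre↔ : ∀ k → 3 * k + 2 * l ≤ n →
           Σ (Σ (Tiling n) (λ t → dimers t ≡ l)) (λ x → trimers (proj₁ x) ≡ k) ↔ Fin (term n k l)
  fibre↔ k le = ↔-trans Σ-assoc (counted↔term n l k (subst (_≤ n) (+-comm (3 * k) _) le))

corollary1 : ((n k : ℕ) → Σ (Tiling n) (λ t → trimers t ≡ k) ↔ Fin (tFormula n k))
           × ((n l : ℕ) → Σ (Tiling n) (λ t → dimers t ≡ l) ↔ Fin (uFormula n l))
corollary1 = tilings-by-trimers , tilings-by-dimers
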